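{- Let $n\ge 1$ and let $T\in\mathcal{C}_n$, i.e. $T$ is a tree on the vertex set $[n]=\{1,\dots,n\}$ (each vertex carrying its own label), rooted at $1$. Then \[ \operatorname{lead}(T) = n-\operatorname{impe}(T), \] where $\operatorname{lead}(T)$ is the number of leading vertices of $T$ and $\operatorname{impe}(T)$ is the number of improper edges of $T$.
   Context: Edges of a rooted tree are oriented: $(i,j)$ is an edge means $i$ is the parent of $j$. For a vertex $v$, $\beta_T(v)$ denotes the smallest label among the descendants of $v$, where $v$ counts as its own descendant. An edge $(i,j)$ is improper if $\lambda_T(i)>\beta_T(j)$ (here $\lambda_T$ is the labelling, so $\lambda_T(i)=i$), and proper otherwise; $\operatorname{impe}(T)$ is the number of improper edges. For a vertex $i$, let $L(i)=(1=a_0,a_1,\dots,a_k=i)$ be the path from the root to $i$. The greater ancestors path of $i$ is the longest terminal segment $(a_p,a_{p+1},\dots,a_k=i)$ of $L(i)$ such that every vertex $j$ in it satisfies $\lambda_T(j)\ge\lambda_T(i)$. The vertex $i$ is called leading if $\beta_T(a_p)=\lambda_T(i)$. $\operatorname{lead}(T)$ denotes the number of leading vertices of $T$. -}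

module Defs where

open import Data.Nat using (ℕ; zero; suc; _≤ᵇ_; _<ᵇ_; _≡ᵇ_; _⊔_; _⊓_)
open import Data.Fin using (Fin; zero; suc; toℕ)
open import Data.Bool using (Bool; true; false; not)
open import Data.List using (List; []; _∷_; map; upTo; allFin; filterᵇ; takeWhileᵇ; length; foldr; last)
open import Data.Maybe using (fromMaybe)
open import Data.Bool.ListAction using (any)
open import Relation.Binary.PropositionalEquality using (_≡_)

iter : {A : Set} → ℕ → (A → A) → A → A
iter zero    f x = x
iter (suc k) f x = f (iter k f x)

-- A rooted tree on the vertex set [n], n = suc m.  Vertex  v : Fin (suc m)
-- carries the label  toℕ v + 1,  so the root (label 1) is  zero.
-- Every non-root vertex v has the parent  parent v ; the edges are
-- (parent v , v) for v ≠ zero.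
-- Acyclicity/connectedness: every vertex reaches the root after m
-- steps up (the path to the root has at most m = n-1 edges).
record Tree (m : ℕ) : Set where
  field
    parent      : Fin (suc m) → Fin (suc m)
    parent-root : parent zero ≡ zero
    reaches     : ∀ v → iter m parent v ≡ zero

module _ {m : ℕ} (T : Tree m) where
  open Tree T

  -- labels are shifted by one uniformly (toℕ v = λ_T(v) - 1); all
  -- comparisons below are invariant under this shift.
  lab : Fin (suc m) → ℕ
  lab = toℕ

  _==_ : Fin (suc m) → Fin (suc m) → Bool
  u == v = toℕ u ≡ᵇ toℕ v

  -- the path from u up to the root: u, parent u, parent² u, …, root
  -- (the root is reached within m steps; trailing copies of the root)
  upPath : Fin (suc m) → List (Fin (suc m))
  upPath u = map (λ k → iter k parent u) (upTo (suc m))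

  isDesc : Fin (suc m) → Fin (suc m) → Bool
  isDesc u v = any (λ a → a == v) (upPath u)

  β : Fin (suc m) → ℕ
  β v = foldr (λ u acc → lab u ⊓ acc) (lab v)
              (filterᵇ (λ u → isDesc u v) (allFin (suc m)))

  isImproperEdge : Fin (suc m) → Bool
  isImproperEdge zero    = false
  isImproperEdge (suc v) = β (suc v) <ᵇ lab (parent (suc v))

  impe : ℕ
  impe = length (filterᵇ isImproperEdge (allFin (suc m)))

  -- a_p: the top vertex of the greater ancestors path of i, i.e. the last
  -- vertex of the longest initial run of  i, parent i, …  whose labels
  -- are all ≥ λ(i)
  gapTop : Fin (suc m) → Fin (suc m)
  gapTop i = fromMaybe i (last (takeWhileᵇ (λ a → lab i ≤ᵇ lab a) (upPath i)))

  isLeading : Fin (suc m) → Bool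
  isLeading i = β (gapTop i) ≡ᵇ lab i

  lead : ℕ
  lead = length (filterᵇ isLeading (allFin (suc m)))

module Submission where

-- Call a vertex v proper if it is the root or the edge (parent v, v) is
-- proper, and write γ(i) for the top of the greater ancestors path of i,
-- so that i is leading iff β(γ(i)) = λ(i).  The heart of the proof is the
-- correspondence
--     i leading and γ(i) = v   ⇔   v proper and λ(i) = β(v).
-- (⇒) the path of i stops at v either at the root or because λ(parent v)
-- < λ(i) = β(v).  (⇐) the vertex labelled β(v) lies below v, every vertex
-- on its path up to v has label ≥ β(v), and parent v has a smaller label
-- because it is ≤ β(v) by properness and cannot lie below v.
-- The relation on the left is the graph of γ restricted to leading
-- vertices, the one on the right the converse of the graph of β restricted
-- to proper vertices; counting its pairs by rows and by columns gives
-- lead(T) = #proper = n − impe(T).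

open import Defs
open import Data.Nat using (ℕ; suc; _∸_)
open import Relation.Binary.PropositionalEquality using (_≡_)

open import Data.Nat using (zero; _+_; _*_; _≤_; _<_; z≤n; s≤s; _≤ᵇ_; _<ᵇ_; _≡ᵇ_; _⊓_)
open import Data.Nat.Properties
  using ( +-0-commutativeMonoid; +-comm; _≤?_; ≤-refl; ≤-trans; ≤-reflexive; <⇒≤; <⇒≱; ≤⇒≯; ≰⇒>; ≰⇒≥; ≮⇒≥; ≤∧≢⇒<
        ; ⊓-sel; m≤n⊓o⇒m≤n; m≤n⊓o⇒m≤o; m∸n+n≡m; m+n∸m≡n; m≤m*n; suc-injective
        ; ≡ᵇ⇒≡; ≡⇒≡ᵇ; <ᵇ⇒<; <⇒<ᵇ; ≤ᵇ⇒≤; ≤⇒≤ᵇ )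
open import Data.Fin using (Fin; zero; suc; toℕ)
open import Data.Fin.Properties using (toℕ-injective; 0≢1+n)
open import Data.Bool using (Bool; true; false; not; _∧_; T)
open import Data.Bool.Properties using (T?; T-∧)
open import Function.Bundles using (module Equivalence)
open Equivalence using (to; from)
open import Data.Bool.ListAction using (any)
open import Data.List using (List; []; _∷_; map; foldr; filterᵇ; takeWhileᵇ; last; length; tabulate; applyUpTo; allFin)
open import Data.List.Properties using (foldr-map; foldr-forcesᵇ; map-upTo)
open import Data.List.Membership.Propositional using (_∈_)
open import Data.List.Membership.Propositional.Properties
  using (∈-map⁺; ∈-filter⁺; ∈-map∘filter⁻; foldr-selective; ∈-allFin)
import Data.List.Relation.Unary.All as All
open import Data.List.Relation.Unary.Any.Properties using (any⁺; any⁻; applyUpTo⁺; applyUpTo⁻)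
open import Data.Maybe using (just; fromMaybe)
open import Data.Product using (∃; _×_; _,_)
open import Data.Sum using (_⊎_; inj₁; inj₂)
import Data.Sum as Sum
open import Data.Unit using (tt)
open import Data.Empty using (⊥-elim)
open import Function using (_∘_; id)
open import Relation.Nullary using (¬_; yes; no)
open import Relation.Binary.PropositionalEquality
  using (_≢_; refl; sym; trans; cong; subst; module ≡-Reasoning)

open import Algebra.Properties.CommutativeMonoid.Sum +-0-commutativeMonoid
  using (sum-syntax; ∑-comm; ∑-distrib-+; sum-cong-≗; sum-replicate-zero)

T-ext : ∀ {a b : Bool} → (T a → T b) → (T b → T a) → a ≡ b
T-ext {false} {false} _ _ = refl
T-ext {false} {true}  _ g = ⊥-elim (g tt)
T-ext {true}  {false} f _ = ⊥-elim (f tt)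
T-ext {true}  {true}  _ _ = refl

not-<ᵇ⇒≥ : ∀ a b → T (not (a <ᵇ b)) → b ≤ a
not-<ᵇ⇒≥ a b t with a <ᵇ b in eq
... | false = ≮⇒≥ (λ a<b → subst T eq (<⇒<ᵇ a<b))

≥⇒not-<ᵇ : ∀ a b → b ≤ a → T (not (a <ᵇ b))
≥⇒not-<ᵇ a b b≤a with a <ᵇ b in eq
... | false = tt
... | true  = ≤⇒≯ b≤a (<ᵇ⇒< a b (subst T (sym eq) tt))

¬≤ᵇ⇒> : ∀ a b → ¬ T (a ≤ᵇ b) → b < a
¬≤ᵇ⇒> a b ¬t = ≰⇒> (¬t ∘ ≤⇒≤ᵇ)

>⇒¬≤ᵇ : ∀ a b → b < a → ¬ T (a ≤ᵇ b)
>⇒¬≤ᵇ a b b<a t = <⇒≱ b<a (≤ᵇ⇒≤ a b t)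

𝟙 : Bool → ℕ
𝟙 true  = 1
𝟙 false = 0

#_ : ∀ {n} → (Fin n → Bool) → ℕ
#_ {n} p = ∑[ i < n ] 𝟙 (p i)

length-filter-tabulate : ∀ {A : Set} n (f : Fin n → A) (p : A → Bool) →
                         length (filterᵇ p (tabulate f)) ≡ # (p ∘ f)
length-filter-tabulate zero    f p = refl
length-filter-tabulate (suc n) f p with p (f zero)
... | true  = cong suc (length-filter-tabulate n (f ∘ suc) p)
... | false = length-filter-tabulate n (f ∘ suc) p

count-complement : ∀ n (p : Fin n → Bool) → # p + # (not ∘ p) ≡ n
count-complement n p = begin
  # p + # (not ∘ p)                     ≡⟨ sym (∑-distrib-+ (𝟙 ∘ p) (𝟙 ∘ not ∘ p)) ⟩
  ∑[ i < n ] (𝟙 (p i) + 𝟙 (not (p i))) ≡⟨ sum-cong-≗ (λ i → one (p i)) ⟩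
  ∑[ i < n ] 1                          ≡⟨ sum-ones n ⟩
  n                                     ∎
  where
  open ≡-Reasoning
  one : ∀ b → 𝟙 b + 𝟙 (not b) ≡ 1
  one true  = refl
  one false = refl
  sum-ones : ∀ n → ∑[ i < n ] 1 ≡ n
  sum-ones zero    = refl
  sum-ones (suc n) = cong suc (sum-ones n)

-- A row (or column) of the graph of a partial function: at most the one
-- entry j = w can be set, and it is set exactly when b holds.
single-match : ∀ {n} (b : Bool) (w : Fin n) → ∑[ j < n ] 𝟙 (b ∧ (toℕ j ≡ᵇ toℕ w)) ≡ 𝟙 b
single-match {n}     false w       = sum-replicate-zero n
single-match {suc n} true  zero    = cong suc (sum-replicate-zero n)
single-match {suc n} true  (suc w) = single-match true w

double-count : ∀ {n k} (P : Fin n → Bool) (Q : Fin k → Bool) (R : Fin n → Fin k → Bool) →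
               (∀ i → ∑[ j < k ] 𝟙 (R i j) ≡ 𝟙 (P i)) →
               (∀ j → ∑[ i < n ] 𝟙 (R i j) ≡ 𝟙 (Q j)) →
               # P ≡ # Q
double-count {n} {k} P Q R rows columns = begin
  # P                             ≡⟨ sum-cong-≗ (sym ∘ rows) ⟩
  ∑[ i < n ] ∑[ j < k ] 𝟙 (R i j) ≡⟨ ∑-comm (λ i j → 𝟙 (R i j)) ⟩
  ∑[ j < k ] ∑[ i < n ] 𝟙 (R i j) ≡⟨ sum-cong-≗ columns ⟩
  # Q                             ∎
  where open ≡-Reasoning

-- Minima of filtered lists, in the shape of the definition of β: the fold
-- computes the minimum of g over the members of xs satisfying p, with
-- default b; it is rewritten as a fold of _⊓_ to use the library lemmas.
module _ {A : Set} (g : A → ℕ) (p : A → Bool) (b : ℕ) (xs : List A) where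

  private
    values : List ℕ
    values = map g (filterᵇ p xs)

    minimum≡ : foldr (λ u acc → g u ⊓ acc) b (filterᵇ p xs) ≡ foldr _⊓_ b values
    minimum≡ = sym (foldr-map _⊓_ g b (filterᵇ p xs))

  min-filter-≤ : ∀ {u} → u ∈ xs → T (p u) → foldr (λ u acc → g u ⊓ acc) b (filterᵇ p xs) ≤ g u
  min-filter-≤ u∈xs pu = subst (_≤ _) (sym minimum≡)
    (All.lookup below (∈-map⁺ g (∈-filter⁺ (T? ∘ p) u∈xs pu)))
    where
    below : All.All (foldr _⊓_ b values ≤_) values
    below = foldr-forcesᵇ (λ x y h → m≤n⊓o⇒m≤n x y h , m≤n⊓o⇒m≤o x y h) b values ≤-refl

  min-filter-attained : foldr (λ u acc → g u ⊓ acc) b (filterᵇ p xs) ≡ b ⊎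
                        ∃ λ u → T (p u) × foldr (λ u acc → g u ⊓ acc) b (filterᵇ p xs) ≡ g u
  min-filter-attained with foldr-selective ⊓-sel b values
  ... | inj₁ is-default = inj₁ (trans minimum≡ is-default)
  ... | inj₂ r∈values with ∈-map∘filter⁻ g (T? ∘ p) {xs = xs} r∈values
  ...   | u , _ , r≡gu , pu = inj₂ (u , pu , trans minimum≡ r≡gu)

iter-+ : ∀ {A : Set} (f : A → A) k j x → iter (k + j) f x ≡ iter k f (iter j f x)
iter-+ f zero    j x = refl
iter-+ f (suc k) j x = cong f (iter-+ f k j x)

iter-periodic : ∀ {A : Set} (f : A → A) c x → iter c f x ≡ x → ∀ j → iter (j * c) f x ≡ x
iter-periodic f c x cycle zero    = refl
iter-periodic f c x cycle (suc j) =
  trans (iter-+ f c (j * c) x) (trans (cong (iter c f) (iter-periodic f c x cycle j)) cycle)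

module _ {A : Set} (p : A → Bool) where

  record RunEnd (m : ℕ) (G : ℕ → A) (d : ℕ) : Set where
    constructor runEnd
    field
      within : d ≤ m
      holds  : ∀ k → k ≤ d → T (p (G k))
      stops  : d ≡ m ⊎ ¬ T (p (G (suc d)))

  runEnd-exists : ∀ m (G : ℕ → A) → T (p (G 0)) → ∃ (RunEnd m G)
  runEnd-exists zero    G p₀ = 0 , runEnd z≤n (λ { zero z≤n → p₀ }) (inj₁ refl)
  runEnd-exists (suc m) G p₀ with T? (p (G 1))
  ... | no ¬p₁ = 0 , runEnd z≤n (λ { zero z≤n → p₀ }) (inj₂ ¬p₁)
  ... | yes p₁ with runEnd-exists m (G ∘ suc) p₁
  ...   | d , runEnd d≤m holds stops = suc d , runEnd (s≤s d≤m) holds′ (Sum.map (cong suc) id stops)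
    where
    holds′ : ∀ k → k ≤ suc d → T (p (G k))
    holds′ zero    _         = p₀
    holds′ (suc k) (s≤s k≤d) = holds k k≤d

  takeWhile-accept : ∀ {x} xs → T (p x) → takeWhileᵇ p (x ∷ xs) ≡ x ∷ takeWhileᵇ p xs
  takeWhile-accept {x} xs px with p x
  ... | true = refl

  takeWhile-reject : ∀ {x} xs → ¬ T (p x) → takeWhileᵇ p (x ∷ xs) ≡ []
  takeWhile-reject {x} xs ¬px with p x
  ... | false = refl
  ... | true  = ⊥-elim (¬px tt)

  last-takeWhile : ∀ m (G : ℕ → A) d → RunEnd m G d →
                   last (takeWhileᵇ p (applyUpTo G (suc m))) ≡ just (G d)
  last-takeWhile zero    G zero    (runEnd _ holds _) = cong last (takeWhile-accept [] (holds 0 z≤n))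
  last-takeWhile zero    G (suc d) (runEnd () _ _)
  last-takeWhile (suc m) G zero    (runEnd _ _ (inj₁ ()))
  last-takeWhile (suc m) G zero    (runEnd _ holds (inj₂ ¬p₁)) = begin
    last (takeWhileᵇ p (G 0 ∷ G 1 ∷ rest)) ≡⟨ cong last (takeWhile-accept _ (holds 0 z≤n)) ⟩
    last (G 0 ∷ takeWhileᵇ p (G 1 ∷ rest)) ≡⟨ cong (λ l → last (G 0 ∷ l)) (takeWhile-reject rest ¬p₁) ⟩
    just (G 0)                             ∎
    where
    open ≡-Reasoning
    rest : List A
    rest = applyUpTo (λ k → G (suc (suc k))) m
  last-takeWhile (suc m) G (suc d) (runEnd (s≤s d≤m) holds stops) = begin
    last (takeWhileᵇ p (G 0 ∷ G 1 ∷ rest)) ≡⟨ cong last (takeWhile-accept _ (holds 0 z≤n)) ⟩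
    last (G 0 ∷ takeWhileᵇ p (G 1 ∷ rest)) ≡⟨ cong (λ l → last (G 0 ∷ l)) G₁-accepted ⟩
    last (G 1 ∷ takeWhileᵇ p rest)         ≡⟨ cong last (sym G₁-accepted) ⟩
    last (takeWhileᵇ p (G 1 ∷ rest))       ≡⟨ last-takeWhile m (G ∘ suc) d tail-run ⟩
    just (G (suc d))                       ∎
    where
    open ≡-Reasoning
    rest : List A
    rest = applyUpTo (λ k → G (suc (suc k))) m
    G₁-accepted : takeWhileᵇ p (G 1 ∷ rest) ≡ G 1 ∷ takeWhileᵇ p rest
    G₁-accepted = takeWhile-accept rest (holds 1 (s≤s z≤n))
    tail-run : RunEnd m (G ∘ suc) d
    tail-run = runEnd d≤m (λ k k≤d → holds (suc k) (s≤s k≤d)) (Sum.map suc-injective id stops)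

module _ {m : ℕ} (τ : Tree m) where
  open Tree τ

  anc : ℕ → Fin (suc m) → Fin (suc m)
  anc k v = iter k parent v

  _≼_ : Fin (suc m) → Fin (suc m) → Set
  u ≼ v = ∃ λ k → anc k u ≡ v

  anc-root : ∀ k → anc k zero ≡ zero
  anc-root zero    = refl
  anc-root (suc k) = trans (cong parent (anc-root k)) parent-root

  anc-beyond : ∀ k v → m ≤ k → anc k v ≡ zero
  anc-beyond k v m≤k = begin
    anc k v               ≡⟨ cong (λ t → anc t v) (sym (m∸n+n≡m m≤k)) ⟩
    anc (k ∸ m + m) v     ≡⟨ iter-+ parent (k ∸ m) m v ⟩
    anc (k ∸ m) (anc m v) ≡⟨ cong (anc (k ∸ m)) (reaches v) ⟩
    anc (k ∸ m) zero      ≡⟨ anc-root (k ∸ m) ⟩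
    zero                  ∎
    where open ≡-Reasoning

  ≼-within : ∀ {u v} → u ≼ v → ∃ λ k → k ≤ m × anc k u ≡ v
  ≼-within {u} (k , top) with k ≤? m
  ... | yes k≤m = k , k≤m , top
  ... | no  k≰m = m , ≤-refl , trans (reaches u) (trans (sym (anc-beyond k u (≰⇒≥ k≰m))) top)

  ≼-on-path : ∀ {u v d k} → anc d u ≡ v → k ≤ d → anc k u ≼ v
  ≼-on-path {u} {d = d} {k} top k≤d =
    d ∸ k , trans (sym (iter-+ parent (d ∸ k) k u)) (trans (cong (λ t → anc t u) (m∸n+n≡m k≤d)) top)

  parent-⋠ : ∀ v → v ≢ zero → ¬ (parent v ≼ v)
  parent-⋠ v v≢0 (k , back) = v≢0 (trans (sym returns) (anc-beyond (m * suc k) v (m≤m*n m (suc k))))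
    where
    cycle : anc (suc k) v ≡ v
    cycle = trans (cong (λ t → anc t v) (+-comm 1 k)) (trans (iter-+ parent k 1 v) back)
    returns : anc (m * suc k) v ≡ v
    returns = iter-periodic parent (suc k) v cycle m

  upPath≡ : ∀ u → upPath τ u ≡ applyUpTo (λ k → anc k u) (suc m)
  upPath≡ u = map-upTo (λ k → anc k u) (suc m)

  isDesc-sound : ∀ u v → T (isDesc τ u v) → u ≼ v
  isDesc-sound u v t with applyUpTo⁻ (λ k → anc k u) {n = suc m}
                            (any⁻ (λ a → toℕ a ≡ᵇ toℕ v) _ (subst (T ∘ any (λ a → toℕ a ≡ᵇ toℕ v)) (upPath≡ u) t))
  ... | k , _ , same = k , toℕ-injective (≡ᵇ⇒≡ _ _ same)

  isDesc-complete : ∀ u v → u ≼ v → T (isDesc τ u v)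
  isDesc-complete u v u≼v with ≼-within u≼v
  ... | k , k≤m , top = subst (T ∘ any (λ a → toℕ a ≡ᵇ toℕ v)) (sym (upPath≡ u))
          (any⁺ _ (applyUpTo⁺ (λ k → anc k u) {n = suc m} (≡⇒≡ᵇ _ _ (cong toℕ top)) (s≤s k≤m)))

  β-≤ : ∀ {u v} → u ≼ v → β τ v ≤ toℕ u
  β-≤ {u} {v} u≼v = min-filter-≤ toℕ (λ w → isDesc τ w v) (toℕ v) (allFin (suc m))
                      (∈-allFin u) (isDesc-complete u v u≼v)

  β-attained : ∀ v → ∃ λ w → w ≼ v × β τ v ≡ toℕ w
  β-attained v with min-filter-attained toℕ (λ w → isDesc τ w v) (toℕ v) (allFin (suc m))
  ... | inj₁ β≡v          = v , (0 , refl) , β≡v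
  ... | inj₂ (w , t , β≡w) = w , isDesc-sound w v t , β≡w

  -- labels are distinct, so the vertex labelled β(v) lies below v
  β-vertex-≼ : ∀ {i v} → toℕ i ≡ β τ v → i ≼ v
  β-vertex-≼ {i} {v} i≡β with β-attained v
  ... | w , w≼v , β≡w = subst (_≼ v) (sym (toℕ-injective (trans i≡β β≡w))) w≼v

  ≥-label : Fin (suc m) → Fin (suc m) → Bool
  ≥-label i a = toℕ i ≤ᵇ toℕ a

  GapEnd : Fin (suc m) → ℕ → Set
  GapEnd i = RunEnd (≥-label i) m (λ k → anc k i)

  gapEnd-exists : ∀ i → ∃ (GapEnd i)
  gapEnd-exists i = runEnd-exists (≥-label i) m (λ k → anc k i) (≤⇒≤ᵇ (≤-refl {toℕ i}))

  gapTop-at : ∀ {i d} → GapEnd i d → gapTop τ i ≡ anc d i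
  gapTop-at {i} {d} end = cong (fromMaybe i) (begin
    last (takeWhileᵇ (≥-label i) (upPath τ i))                         ≡⟨ cong (last ∘ takeWhileᵇ (≥-label i)) (upPath≡ i) ⟩
    last (takeWhileᵇ (≥-label i) (applyUpTo (λ k → anc k i) (suc m))) ≡⟨ last-takeWhile (≥-label i) m (λ k → anc k i) d end ⟩
    just (anc d i)                                                     ∎)
    where open ≡-Reasoning

  isProper : Fin (suc m) → Bool
  isProper v = not (isImproperEdge τ v)

  -- (⇒) if the greater ancestors path of i ends at v and β(v) = λ(i), then
  -- v is proper: either v is the root, or the path stopped because
  -- λ(parent v) < λ(i) = β(v).
  gapTop-proper : ∀ {i d} v → GapEnd i d → anc d i ≡ v → β τ v ≡ toℕ i → T (isProper v)
  gapTop-proper zero    _                     _   _   = tt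
  gapTop-proper {i} (suc v) (runEnd _ _ (inj₁ refl)) top _ = ⊥-elim (0≢1+n (trans (sym (reaches i)) top))
  gapTop-proper {i} {d} (suc v) (runEnd _ _ (inj₂ stop)) top β≡i =
    ≥⇒not-<ᵇ (β τ (suc v)) (toℕ (parent (suc v)))
      (≤-trans (<⇒≤ parent<i) (≤-reflexive (sym β≡i)))
    where
    parent<i : toℕ (parent (suc v)) < toℕ i
    parent<i = ¬≤ᵇ⇒> (toℕ i) _ (subst (λ a → ¬ T (≥-label i a)) (cong parent top) stop)

  leading⇒proper : ∀ i v → T (isLeading τ i) → gapTop τ i ≡ v → T (isProper v) × toℕ i ≡ β τ v
  leading⇒proper i v leading gap≡v with gapEnd-exists i
  ... | d , end = gapTop-proper v end (trans (sym (gapTop-at end)) gap≡v) β≡i , sym β≡i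
    where
    β≡i : β τ v ≡ toℕ i
    β≡i = subst (λ a → β τ a ≡ toℕ i) gap≡v (≡ᵇ⇒≡ _ _ leading)

  path-≥-β : ∀ {i v d} → anc d i ≡ v → ∀ k → k ≤ d → β τ v ≤ toℕ (anc k i)
  path-≥-β top k k≤d = β-≤ (≼-on-path top k≤d)

  -- (⇐) if v is proper and λ(i) = β(v), the greater ancestors path of i
  -- ends exactly at v: all labels up to v are ≥ β(v), and above v either
  -- the root is reached or λ(parent v) < λ(i) (it is ≤ β(v) by properness,
  -- and parent v ≠ i because i lies below v).
  gapEnd-at : ∀ {i} v → T (isProper v) → toℕ i ≡ β τ v → ∃ λ d → GapEnd i d × anc d i ≡ v
  gapEnd-at {i} zero _ i≡β =
    m , runEnd ≤-refl (above (reaches i)) (inj₁ refl) , reaches i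
    where
    above : anc m i ≡ zero → ∀ k → k ≤ m → T (≥-label i (anc k i))
    above top k k≤m = ≤⇒≤ᵇ (subst (_≤ toℕ (anc k i)) (sym i≡β) (path-≥-β top k k≤m))
  gapEnd-at {i} (suc v) proper i≡β with ≼-within (β-vertex-≼ i≡β)
  ... | d , d≤m , top = d , runEnd d≤m above (inj₂ stops) , top
    where
    above : ∀ k → k ≤ d → T (≥-label i (anc k i))
    above k k≤d = ≤⇒≤ᵇ (subst (_≤ toℕ (anc k i)) (sym i≡β) (path-≥-β top k k≤d))
    parent≢i : toℕ (parent (suc v)) ≢ toℕ i
    parent≢i same = parent-⋠ (suc v) (λ ())
                      (subst (_≼ suc v) (sym (toℕ-injective same)) (β-vertex-≼ i≡β))
    parent<i : toℕ (parent (suc v)) < toℕ i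
    parent<i = ≤∧≢⇒< (≤-trans (not-<ᵇ⇒≥ _ _ proper) (≤-reflexive (sym i≡β))) parent≢i
    stops : ¬ T (≥-label i (anc (suc d) i))
    stops = subst (λ a → ¬ T (≥-label i a)) (sym (cong parent top)) (>⇒¬≤ᵇ (toℕ i) _ parent<i)

  proper⇒leading : ∀ i v → T (isProper v) → toℕ i ≡ β τ v → T (isLeading τ i) × gapTop τ i ≡ v
  proper⇒leading i v proper i≡β with gapEnd-at v proper i≡β
  ... | d , end , top = subst (λ a → T (β τ a ≡ᵇ toℕ i)) (sym gap≡v) (≡⇒≡ᵇ _ _ (sym i≡β)) , gap≡v
    where
    gap≡v : gapTop τ i ≡ v
    gap≡v = trans (gapTop-at end) top

  correspondence : ∀ i v → (isLeading τ i ∧ (toℕ v ≡ᵇ toℕ (gapTop τ i)))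
                         ≡ (isProper v ∧ (toℕ i ≡ᵇ β τ v))
  correspondence i v = T-ext forward backward
    where
    forward : T (isLeading τ i ∧ (toℕ v ≡ᵇ toℕ (gapTop τ i))) → T (isProper v ∧ (toℕ i ≡ᵇ β τ v))
    forward t with T-∧ .to t
    ... | leading , same with leading⇒proper i v leading (sym (toℕ-injective (≡ᵇ⇒≡ _ _ same)))
    ...   | proper , i≡β = T-∧ .from (proper , ≡⇒≡ᵇ _ _ i≡β)
    backward : T (isProper v ∧ (toℕ i ≡ᵇ β τ v)) → T (isLeading τ i ∧ (toℕ v ≡ᵇ toℕ (gapTop τ i)))
    backward t with T-∧ .to t
    ... | proper , same with proper⇒leading i v proper (≡ᵇ⇒≡ _ _ same)
    ...   | leading , gap≡v = T-∧ .from (leading , ≡⇒≡ᵇ _ _ (cong toℕ (sym gap≡v)))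

  -- Counting the correspondence by rows (γ is a function) and by columns
  -- (β(v) is the label of exactly one vertex) gives lead = #proper.
  lead≡#proper : lead τ ≡ # isProper
  lead≡#proper = begin
    lead τ          ≡⟨ length-filter-tabulate (suc m) id (isLeading τ) ⟩
    # isLeading τ   ≡⟨ double-count (isLeading τ) isProper R rows columns ⟩
    # isProper      ∎
    where
    open ≡-Reasoning
    R : Fin (suc m) → Fin (suc m) → Bool
    R i v = isLeading τ i ∧ (toℕ v ≡ᵇ toℕ (gapTop τ i))
    rows : ∀ i → ∑[ v < suc m ] 𝟙 (R i v) ≡ 𝟙 (isLeading τ i)
    rows i = single-match (isLeading τ i) (gapTop τ i)
    columns : ∀ v → ∑[ i < suc m ] 𝟙 (R i v) ≡ 𝟙 (isProper v)
    columns v with β-attained v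
    ... | w , _ , β≡w = trans (sum-cong-≗ (λ i → cong 𝟙 (trans (correspondence i v)
                                 (cong (λ b → isProper v ∧ (toℕ i ≡ᵇ b)) β≡w))))
                              (single-match (isProper v) w)

  impe+#proper : impe τ + # isProper ≡ suc m
  impe+#proper = trans (cong (_+ # isProper) (length-filter-tabulate (suc m) id (isImproperEdge τ)))
                       (count-complement (suc m) (isImproperEdge τ))

lemma11 : (m : ℕ) (T : Tree m) → lead T ≡ suc m ∸ impe T
lemma11 m τ = begin
  lead τ                          ≡⟨ lead≡#proper τ ⟩
  # isProper τ                    ≡⟨ sym (m+n∸m≡n (impe τ) (# isProper τ)) ⟩
  impe τ + # isProper τ ∸ impe τ  ≡⟨ cong (_∸ impe τ) (impe+#proper τ) ⟩
  suc m ∸ impe τ                  ∎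
  where open ≡-Reasoning
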